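{- Work in $\mathbf{CZF}$. Full NID implies that for every set $P$ of propositional letters and every game theory $T$ over $P$, the class of models of $T$ is set-generated (as a class of subsets of $P$). Likewise, finitary NID implies that the class of models of any finitary game theory over $P$ is set-generated, and elementary NID implies that the class of models of any elementary game theory over $P$ is set-generated.
   Context: Let $P$ be a set of propositional letters. A game formula over $P$ is built from letters in $P$ using set-indexed infinitary disjunctions $\bigvee_{i\in I}$ and conjunctions $\bigwedge_{i\in I}$ ($I$ a set), with no implications or negations. A game sequent is $\varphi\to\psi$ with $\varphi,\psi$ game formulas; a game theory is a set of game sequents. A finitary game formula is one in which all conjunctions are indexed by finite sets (images of some $\{1,\dots,n\}$); an elementary game formula is one containing no conjunctions. A finitary (elementary) game sequent is one whose hypothesis $\varphi$ is finitary (elementary); a finitary (elementary) game theory is a set of such sequents. A model is identified with a subset $M\subseteq P$ (the true letters), with the evident satisfaction relation: $M\models p$ iff $p\in M$, $\bigwedge$ holds iff all conjuncts hold, $\bigvee$ holds iff some disjunct holds, and $M\models T$ iff for each $\varphi\to\psi\in T$, $M\models\varphi$ implies $M\models\psi$. A class $\mathcal M$ of subsets of $P$ is set-generated if there is a set $G\subseteq\mathcal M$ with $\forall\alpha\in\mathcal M\,\forall x\in\alpha\,\exists\beta\in G\,x\in\beta\subseteq\alpha$. A rule on a set $X$ is a pair $(a,b)$ of subsets of $X$, elementary if $a$ is a singleton, finitary if $a$ finite; $Y\subseteq X$ is closed under it if $a\subseteq Y$ implies $b\cap Y$ inhabited. Full NID: for every set $X$ and set $\mathcal R$ of rules on $X$,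 the class of subsets of $X$ closed under all rules in $\mathcal R$ is set-generated; finitary (elementary) NID is the same restricted to finitary (elementary) rules. -}

module Defs where

open import Level using (Level; _⊔_) renaming (suc to lsuc; zero to lzero)
open import Data.Nat using (ℕ)
open import Data.Fin using (Fin)
open import Data.Product using (Σ; ∃; _×_; _,_)
open import Relation.Binary.PropositionalEquality using (_≡_)

-- Sets of the ambient (CZF-like) theory are types in Set; subsets of a set X
-- are Set-valued predicates X → Set; classes of subsets are Set₁-valued
-- predicates on (X → Set). A "set of things" is a family indexed by a set.

Subset : Set → Set₁
Subset X = X → Set

_⊆_ : {X : Set} → Subset X → Subset X → Set
A ⊆ B = ∀ x → A x → B x

IsFiniteSet : Set → Set
IsFiniteSet I = Σ ℕ λ n → Σ (Fin n → I) λ f → ∀ i → Σ (Fin n) λ k → f k ≡ i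

SetGenerated : {X : Set} → (Subset X → Set₁) → Set₁
SetGenerated {X} 𝓜 =
  Σ Set λ Idx → Σ (Idx → Subset X) λ G →
    (∀ i → 𝓜 (G i)) ×
    (∀ α → 𝓜 α → ∀ x → α x → Σ Idx λ i → G i x × (G i ⊆ α))

data GForm (P : Set) : Set₁ where
  atom : P → GForm P
  ⋁    : (I : Set) → (I → GForm P) → GForm P
  ⋀    : (I : Set) → (I → GForm P) → GForm P

data Finitary {P : Set} : GForm P → Set₁ where
  atomF : (p : P) → Finitary (atom p)
  ⋁F    : (I : Set) (f : I → GForm P) → (∀ i → Finitary (f i)) → Finitary (⋁ I f)
  ⋀F    : (I : Set) (f : I → GForm P) → IsFiniteSet I →
          (∀ i → Finitary (f i)) → Finitary (⋀ I f)

data Elementary {P : Set} : GForm P → Set₁ where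
  atomE : (p : P) → Elementary (atom p)
  ⋁E    : (I : Set) (f : I → GForm P) → (∀ i → Elementary (f i)) → Elementary (⋁ I f)

record GSequent (P : Set) : Set₁ where
  constructor _⇒_
  field
    hyp  : GForm P
    conc : GForm P

record GTheory (P : Set) : Set₁ where
  field
    Idx : Set
    seq : Idx → GSequent P

FinitaryTheory : {P : Set} → GTheory P → Set₁
FinitaryTheory T = ∀ j → Finitary (GSequent.hyp (GTheory.seq T j))

ElementaryTheory : {P : Set} → GTheory P → Set₁
ElementaryTheory T = ∀ j → Elementary (GSequent.hyp (GTheory.seq T j))

_⊨_ : {P : Set} → Subset P → GForm P → Set
M ⊨ atom p  = M p
M ⊨ ⋁ I f   = Σ I λ i → M ⊨ f i
M ⊨ ⋀ I f   = ∀ i → M ⊨ f i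

_⊨T_ : {P : Set} → Subset P → GTheory P → Set
M ⊨T T = ∀ j → M ⊨ GSequent.hyp (GTheory.seq T j) → M ⊨ GSequent.conc (GTheory.seq T j)

Models : {P : Set} → GTheory P → Subset P → Set₁
Models T M = Level.Lift (lsuc lzero) (M ⊨T T)

record Rule (X : Set) : Set₁ where
  constructor rule
  field
    pre  : Subset X
    post : Subset X

ElementaryRule : {X : Set} → Rule X → Set
ElementaryRule {X} r = Σ X λ x₀ → ∀ x → (Rule.pre r x → x ≡ x₀) × (x ≡ x₀ → Rule.pre r x)

FinitaryRule : {X : Set} → Rule X → Set
FinitaryRule {X} r =
  Σ ℕ λ n → Σ (Fin n → X) λ f →
    ∀ x → (Rule.pre r x → Σ (Fin n) λ k → f k ≡ x) × (Σ (Fin n) (λ k → f k ≡ x) → Rule.pre r x)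

ClosedUnder : {X : Set} → Rule X → Subset X → Set
ClosedUnder r Y = Rule.pre r ⊆ Y → Σ _ λ x → Rule.post r x × Y x

Closed : {X : Set} {K : Set} → (K → Rule X) → Subset X → Set₁
Closed R Y = Level.Lift (lsuc lzero) (∀ k → ClosedUnder (R k) Y)

NIDFor : ({X : Set} → Rule X → Set) → Set₁
NIDFor Q = (X : Set) (K : Set) (R : K → Rule X) → (∀ k → Q (R k)) → SetGenerated (Closed R)

FullNID : Set₁
FullNID = (X : Set) (K : Set) (R : K → Rule X) → SetGenerated (Closed R)

FinitaryNID : Set₁
FinitaryNID = NIDFor FinitaryRule

ElementaryNID : Set₁
ElementaryNID = NIDFor ElementaryRule

-- Models of T are coded as the subsets of X = P ⊎ {occurrences of subformulas of
-- conclusions of T} closed under rules of two kinds. Every hypothesis is a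
-- disjunction of conjunctions of letters, and each such clause yields a rule
-- "clause ⊆ Y ⇒ root of the conclusion ∈ Y". Each occurrence of a disjunction,
-- conjunction or letter yields elementary rules passing from it to some
-- disjunct, to every conjunct, or to the letter. A model α extends to the closed
-- set of occurrences it satisfies, and every closed set restricts to a model, so
-- the generators given by NID restrict to generators of the models. For
-- finitary (elementary) hypotheses the clauses are finite (singletons), hence all
-- rules are finitary (elementary).
module Submission where

open import Defs
open import Data.Empty using (⊥)
open import Data.Fin using (Fin; zero)
open import Data.List using (List; [_]; concat; tabulate; lookup; length)
open import Data.List.Membership.Propositional.Properties using (∈-lookup)
open import Data.List.Relation.Unary.All as All using (All)
open import Data.List.Relation.Unary.All.Properties using (concat⁺; concat⁻; tabulate⁺; tabulate⁻)
open import Data.List.Relation.Unary.Any using (index)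
open import Data.List.Relation.Unary.Any.Properties using (lookup-index)
open import Data.Maybe using (Maybe; just; nothing)
open import Data.Product using (Σ; _×_; _,_; proj₁; proj₂)
open import Data.Sum using (_⊎_; inj₁; inj₂)
open import Data.Unit using (⊤; tt)
open import Function using (_∘_; id)
open import Function.Bundles using (_⇔_; mk⇔; Equivalence)
open import Level using (lift; lower)
open import Relation.Binary.PropositionalEquality using (_≡_; refl; sym; subst)

Image : {A X : Set} → (A → X) → Subset X
Image {A} f x = Σ A λ a → f a ≡ x

Image-finitary : ∀ {X n} (f : Fin n → X) (post : Subset X) → FinitaryRule (rule (Image f) post)
Image-finitary {n = n} f post = n , f , λ x → id , id

Image-⊤-elementary : ∀ {X} (f : ⊤ → X) (post : Subset X) → ElementaryRule (rule (Image f) post)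
Image-⊤-elementary f post = f tt , λ x → (λ { (tt , eq) → sym eq }) , λ eq → tt , sym eq

Elementary⇒Finitary : ∀ {X} {r : Rule X} → ElementaryRule r → FinitaryRule r
Elementary⇒Finitary (x₀ , pre⇔) =
  1 , (λ _ → x₀) ,
  λ x → (λ p → zero , sym (proj₁ (pre⇔ x) p)) , λ { (_ , eq) → proj₂ (pre⇔ x) (sym eq) }

fire : ∀ {X} {a : X} {post Y : Subset X} →
       ClosedUnder (rule (_≡ a) post) Y → Y a → Σ X λ x → post x × Y x
fire {Y = Y} closed Ya = closed λ x eq → subst Y (sym eq) Ya

module _ {P : Set} where

  mutual
    Position : GForm P → Set
    Position φ = Maybe (Below φ)

    Below : GForm P → Set
    Below (atom p) = ⊥
    Below (⋁ I f) = Σ I (Position ∘ f)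
    Below (⋀ I f) = Σ I (Position ∘ f)

  pattern here = nothing
  pattern child i n = just (i , n)

  infix 25 _at_

  _at_ : (φ : GForm P) → Position φ → GForm P
  φ at here = φ
  atom p at just ()
  ⋁ I f at child i n = f i at n
  ⋀ I f at child i n = f i at n

  Step : GForm P → Set
  Step (atom p) = ⊤
  Step (⋁ I f) = ⊤ ⊎ Σ I (Step ∘ f)
  Step (⋀ I f) = I ⊎ Σ I (Step ∘ f)

  module _ {X : Set} (inP : P → X) where

    unfold : (φ : GForm P) → (Position φ → X) → Step φ → Rule X
    unfold (atom p) emb _ = rule (_≡ emb here) (_≡ inP p)
    unfold (⋁ I f) emb (inj₁ _) = rule (_≡ emb here) (λ x → Σ I λ i → x ≡ emb (child i here))
    unfold (⋀ I f) emb (inj₁ i) = rule (_≡ emb here) (_≡ emb (child i here))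
    unfold (⋁ I f) emb (inj₂ (i , s)) = unfold (f i) (emb ∘ child i) s
    unfold (⋀ I f) emb (inj₂ (i , s)) = unfold (f i) (emb ∘ child i) s

    unfold-elementary : ∀ φ emb s → ElementaryRule (unfold φ emb s)
    unfold-elementary (atom p) emb _ = emb here , λ x → id , id
    unfold-elementary (⋁ I f) emb (inj₁ _) = emb here , λ x → id , id
    unfold-elementary (⋀ I f) emb (inj₁ i) = emb here , λ x → id , id
    unfold-elementary (⋁ I f) emb (inj₂ (i , s)) = unfold-elementary (f i) (emb ∘ child i) s
    unfold-elementary (⋀ I f) emb (inj₂ (i , s)) = unfold-elementary (f i) (emb ∘ child i) s

    unfold-sound : ∀ φ emb (Y : Subset X) → (∀ s → ClosedUnder (unfold φ emb s) Y) →
                   Y (emb here) → (Y ∘ inP) ⊨ φ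
    unfold-sound (atom p) emb Y closed Yr with fire (closed tt) Yr
    ... | x , eq , Yx = subst Y eq Yx
    unfold-sound (⋁ I f) emb Y closed Yr with fire (closed (inj₁ tt)) Yr
    ... | x , (i , eq) , Yx =
      i , unfold-sound (f i) (emb ∘ child i) Y (closed ∘ inj₂ ∘ (i ,_)) (subst Y eq Yx)
    unfold-sound (⋀ I f) emb Y closed Yr i with fire (closed (inj₁ i)) Yr
    ... | x , eq , Yx =
      unfold-sound (f i) (emb ∘ child i) Y (closed ∘ inj₂ ∘ (i ,_)) (subst Y eq Yx)

    unfold-complete : ∀ φ emb (Y : Subset X) (α : Subset P) → α ⊆ (Y ∘ inP) →
                      (∀ n → Y (emb n) ⇔ α ⊨ φ at n) → ∀ s → ClosedUnder (unfold φ emb s) Y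
    unfold-complete (atom p) emb Y α α⊆Y Y⇔ _ pre⊆Y =
      inP p , refl , α⊆Y p (Equivalence.to (Y⇔ here) (pre⊆Y _ refl))
    unfold-complete (⋁ I f) emb Y α α⊆Y Y⇔ (inj₁ _) pre⊆Y
      with Equivalence.to (Y⇔ here) (pre⊆Y _ refl)
    ... | i , αfi = emb (child i here) , (i , refl) , Equivalence.from (Y⇔ (child i here)) αfi
    unfold-complete (⋀ I f) emb Y α α⊆Y Y⇔ (inj₁ i) pre⊆Y =
      emb (child i here) , refl ,
      Equivalence.from (Y⇔ (child i here)) (Equivalence.to (Y⇔ here) (pre⊆Y _ refl) i)
    unfold-complete (⋁ I f) emb Y α α⊆Y Y⇔ (inj₂ (i , s)) =
      unfold-complete (f i) (emb ∘ child i) Y α α⊆Y (Y⇔ ∘ child i) s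
    unfold-complete (⋀ I f) emb Y α α⊆Y Y⇔ (inj₂ (i , s)) =
      unfold-complete (f i) (emb ∘ child i) Y α α⊆Y (Y⇔ ∘ child i) s

  record DNF (φ : GForm P) : Set₁ where
    field
      Clause   : Set
      Literal  : Clause → Set
      literal  : (c : Clause) → Literal c → P
      sound    : ∀ α c → (∀ l → α (literal c l)) → α ⊨ φ
      complete : ∀ α → α ⊨ φ → Σ Clause λ c → ∀ l → α (literal c l)

  -- A clause chooses one disjunct of every disjunction it meets.
  Clause : GForm P → Set
  Clause (atom p) = ⊤
  Clause (⋁ I f) = Σ I (Clause ∘ f)
  Clause (⋀ I f) = (i : I) → Clause (f i)

  Literal : (φ : GForm P) → Clause φ → Set
  Literal (atom p) _ = ⊤
  Literal (⋁ I f) (i , c) = Literal (f i) c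
  Literal (⋀ I f) c = Σ I λ i → Literal (f i) (c i)

  literal : (φ : GForm P) (c : Clause φ) → Literal φ c → P
  literal (atom p) _ _ = p
  literal (⋁ I f) (i , c) l = literal (f i) c l
  literal (⋀ I f) c (i , l) = literal (f i) (c i) l

  clause-sound : ∀ α φ c → (∀ l → α (literal φ c l)) → α ⊨ φ
  clause-sound α (atom p) _ αc = αc tt
  clause-sound α (⋁ I f) (i , c) αc = i , clause-sound α (f i) c αc
  clause-sound α (⋀ I f) c αc i = clause-sound α (f i) (c i) (αc ∘ (i ,_))

  clause-complete : ∀ α φ → α ⊨ φ → Σ (Clause φ) λ c → ∀ l → α (literal φ c l)
  clause-complete α (atom p) αφ = tt , λ _ → αφ
  clause-complete α (⋁ I f) (i , αfi) with clause-complete α (f i) αfi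
  ... | c , αc = (i , c) , αc
  clause-complete α (⋀ I f) αφ =
    (proj₁ ∘ conjunct) , λ { (i , l) → proj₂ (conjunct i) l }
    where
    conjunct : ∀ i → Σ (Clause (f i)) λ c → ∀ l → α (literal (f i) c l)
    conjunct i = clause-complete α (f i) (αφ i)

  dnf : ∀ φ → DNF φ
  dnf φ = record
    { Clause = Clause φ ; Literal = Literal φ ; literal = literal φ
    ; sound = λ α → clause-sound α φ ; complete = λ α → clause-complete α φ }

  atoms : ∀ {φ} → Finitary φ → Clause φ → List P
  atoms (atomF p) _ = [ p ]
  atoms (⋁F I f F) (i , c) = atoms (F i) c
  atoms (⋀F I f (m , e , _) F) c = concat (tabulate λ k → atoms (F (e k)) (c (e k)))

  atoms-sound : ∀ α {φ} (F : Finitary φ) c → All α (atoms F c) → α ⊨ φ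
  atoms-sound α (atomF p) _ (αp All.∷ _) = αp
  atoms-sound α (⋁F I f F) (i , c) αc = i , atoms-sound α (F i) c αc
  atoms-sound α (⋀F I f (m , e , onto) F) c αc i with onto i
  ... | k , refl = atoms-sound α (F (e k)) (c (e k)) (tabulate⁻ (concat⁻ αc) k)

  atoms-complete : ∀ α {φ} (F : Finitary φ) → α ⊨ φ → Σ (Clause φ) λ c → All α (atoms F c)
  atoms-complete α (atomF p) αp = tt , αp All.∷ All.[]
  atoms-complete α (⋁F I f F) (i , αfi) with atoms-complete α (F i) αfi
  ... | c , αc = (i , c) , αc
  atoms-complete α (⋀F I f (m , e , _) F) αφ =
    (proj₁ ∘ conjunct) , concat⁺ (tabulate⁺ (proj₂ ∘ conjunct ∘ e))
    where
    conjunct : ∀ i → Σ (Clause (f i)) λ c → All α (atoms (F i) c)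
    conjunct i = atoms-complete α (F i) (αφ i)

  All⇒lookup : ∀ {α : Subset P} {xs} → All α xs → ∀ k → α (lookup xs k)
  All⇒lookup αxs k = All.lookup αxs (∈-lookup k)

  lookup⇒All : ∀ {α : Subset P} xs → (∀ k → α (lookup xs k)) → All α xs
  lookup⇒All {α} xs αxs = All.tabulate λ x∈ → subst α (sym (lookup-index x∈)) (αxs (index x∈))

  finitaryDNF : ∀ {φ} → Finitary φ → DNF φ
  finitaryDNF {φ} F = record
    { Clause = Clause φ ; Literal = Fin ∘ length ∘ atoms F ; literal = lookup ∘ atoms F
    ; sound = λ α c → atoms-sound α F c ∘ lookup⇒All (atoms F c)
    ; complete = λ α αφ → let c , αc = atoms-complete α F αφ in c , All⇒lookup αc }

  atomOf : ∀ {φ} → Elementary φ → Clause φ → P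
  atomOf (atomE p) _ = p
  atomOf (⋁E I f E) (i , c) = atomOf (E i) c

  atomOf-sound : ∀ α {φ} (E : Elementary φ) c → α (atomOf E c) → α ⊨ φ
  atomOf-sound α (atomE p) _ αp = αp
  atomOf-sound α (⋁E I f E) (i , c) αc = i , atomOf-sound α (E i) c αc

  atomOf-complete : ∀ α {φ} (E : Elementary φ) → α ⊨ φ → Σ (Clause φ) λ c → α (atomOf E c)
  atomOf-complete α (atomE p) αp = tt , αp
  atomOf-complete α (⋁E I f E) (i , αfi) with atomOf-complete α (E i) αfi
  ... | c , αc = (i , c) , αc

  elementaryDNF : ∀ {φ} → Elementary φ → DNF φ
  elementaryDNF {φ} E = record
    { Clause = Clause φ ; Literal = λ _ → ⊤ ; literal = λ c _ → atomOf E c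
    ; sound = λ α c αc → atomOf-sound α E c (αc tt)
    ; complete = λ α αφ → let c , αc = atomOf-complete α E αφ in c , λ _ → αc }

  module RuleSystem (T : GTheory P) (hypDNF : ∀ j → DNF (GSequent.hyp (GTheory.seq T j))) where
    open GTheory T

    conc : Idx → GForm P
    conc j = GSequent.conc (seq j)

    X : Set
    X = P ⊎ Σ Idx (Position ∘ conc)

    node : ∀ j → Position (conc j) → X
    node j n = inj₂ (j , n)

    K : Set
    K = Σ Idx (DNF.Clause ∘ hypDNF) ⊎ Σ Idx (Step ∘ conc)

    R : K → Rule X
    R (inj₁ (j , c)) = rule (Image (inj₁ ∘ DNF.literal (hypDNF j) c)) (_≡ node j here)
    R (inj₂ (j , s)) = unfold inj₁ (conc j) (node j) s

    extend : Subset P → Subset X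
    extend α (inj₁ p) = α p
    extend α (inj₂ (j , n)) = α ⊨ conc j at n

    extend-closed : ∀ α → α ⊨T T → ∀ k → ClosedUnder (R k) (extend α)
    extend-closed α α⊨T (inj₁ (j , c)) literals⊆ =
      node j here , refl , α⊨T j (DNF.sound (hypDNF j) α c λ l → literals⊆ _ (l , refl))
    extend-closed α α⊨T (inj₂ (j , s)) =
      unfold-complete inj₁ (conc j) (node j) (extend α) α (λ p → id) (λ n → mk⇔ id id) s

    restrict-model : ∀ Y → (∀ k → ClosedUnder (R k) Y) → (Y ∘ inj₁) ⊨T T
    restrict-model Y closed j Y⊨hyp with DNF.complete (hypDNF j) (Y ∘ inj₁) Y⊨hyp
    ... | c , Yc with closed (inj₁ (j , c)) (λ { _ (l , refl) → Yc l })
    ... | _ , refl , Yroot =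
      unfold-sound inj₁ (conc j) (node j) Y (closed ∘ inj₂ ∘ (j ,_)) Yroot

    Models-setGenerated : SetGenerated (Closed R) → SetGenerated (Models T)
    Models-setGenerated (G , gen , gen-closed , gen-covers) =
      G , (λ g → gen g ∘ inj₁) ,
      (λ g → lift (restrict-model (gen g) (lower (gen-closed g)))) ,
      λ α α⊨T p αp →
        let g , gen-p , gen⊆ =
              gen-covers (extend α) (lift (extend-closed α (lower α⊨T))) (inj₁ p) αp
        in g , gen-p , λ q → gen⊆ (inj₁ q)

  module _ (T : GTheory P) (F : FinitaryTheory T) where
    open RuleSystem T (finitaryDNF ∘ F)

    finitary-rules : ∀ k → FinitaryRule (R k)
    finitary-rules (inj₁ (j , c)) = Image-finitary _ (_≡ node j here)
    finitary-rules (inj₂ (j , s)) =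
      Elementary⇒Finitary {r = R (inj₂ (j , s))} (unfold-elementary inj₁ (conc j) (node j) s)

  module _ (T : GTheory P) (E : ElementaryTheory T) where
    open RuleSystem T (elementaryDNF ∘ E)

    elementary-rules : ∀ k → ElementaryRule (R k)
    elementary-rules (inj₁ (j , c)) = Image-⊤-elementary _ (_≡ node j here)
    elementary-rules (inj₂ (j , s)) = unfold-elementary inj₁ (conc j) (node j) s

theorem4p2 : (FullNID → (P : Set) (T : GTheory P) → SetGenerated (Models T))
    × (FinitaryNID → (P : Set) (T : GTheory P) → FinitaryTheory T → SetGenerated (Models T))
    × (ElementaryNID → (P : Set) (T : GTheory P) → ElementaryTheory T → SetGenerated (Models T))
theorem4p2 =
  (λ nid P T → Models-setGenerated T (λ _ → dnf _) (nid _ _ _)) ,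
  (λ nid P T F → Models-setGenerated T (finitaryDNF ∘ F) (nid _ _ _ (finitary-rules T F))) ,
  (λ nid P T E → Models-setGenerated T (elementaryDNF ∘ E) (nid _ _ _ (elementary-rules T E)))
  where open RuleSystem using (Models-setGenerated)
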